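{- Let $D=(G,\mathcal{O},w)$ be a weighted oriented graph, let $A\subseteq V^{+}$, and let $\mathcal{C}$ be a vertex cover of $D$ with $N_D^{+}(A)\subseteq\mathcal{C}$. Then there is a strong vertex cover $\mathcal{C}'$ of $D$ such that $N_D^{+}(A)\subseteq\mathcal{C}'\subseteq\mathcal{C}$.
   Context: A weighted oriented graph is a triple $D=(G,\mathcal{O},w)$ with $G$ a finite simple graph, $\mathcal{O}$ an orientation of its edges, $w:V(G)\to\mathbb{N}$; $E(D)$ is the set of oriented edges. $V^{+}=\{x\mid w(x)>1\}$. $N_D^{+}(x)=\{y\mid(x,y)\in E(D)\}$, $N_D^{ - }(x)=\{y\mid(y,x)\in E(D)\}$, $N_D(x)=N_D^+(x)\cup N_D^-(x)$; $N_D^+(A)=\bigcup_{a\in A}N_D^+(a)$. Standing convention: every source (vertex with $N_D^-(x)=\emptyset$) has weight $1$. A vertex cover of $D$ is a set of vertices meeting every edge. For a vertex cover $\mathcal{C}$: $L_1(\mathcal{C})=\{x\in\mathcal{C}\mid N_D^+(x)\setminus\mathcal{C}\ne\emptyset\}$, $L_2(\mathcal{C})=\{x\in\mathcal{C}\setminus L_1(\mathcal{C})\mid N_D^-(x)\setminus\mathcal{C}\ne\emptyset\}$, $L_3(\mathcal{C})=\mathcal{C}\setminus(L_1(\mathcal{C})\cup L_2(\mathcal{C}))$. $\mathcal{C}$ is strong if for every $x\in L_3(\mathcal{C})$ there is $(y,x)\in E(D)$ with $y\in(\mathcal{C}\setminus L_1(\mathcal{C}))\cap V^+$. -}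

module Defs where

open import Data.Nat using (ℕ; _>_)
open import Data.Fin using (Fin)
open import Data.Fin.Subset using (Subset; _∈_; _∉_; _⊆_)
open import Data.Bool using (Bool; true; false)
open import Data.Product using (Σ; ∃; ∃-syntax; _×_; _,_)
open import Data.Sum using (_⊎_)
open import Relation.Nullary using (¬_)
open import Relation.Binary.PropositionalEquality using (_≡_)

record WOG (n : ℕ) : Set where
  field
    arc     : Fin n → Fin n → Bool
    weight  : Fin n → ℕ
    noLoop  : ∀ x → arc x x ≡ false
    oriented : ∀ x y → arc x y ≡ true → arc y x ≡ false
    weight-pos : ∀ x → weight x > 0
    -- standing convention: sources have weight 1
    sourceWeight : ∀ x → (∀ y → arc y x ≡ false) → weight x ≡ 1

module _ {n : ℕ} (D : WOG n) where
  open WOG D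

  Edge : Fin n → Fin n → Set
  Edge x y = arc x y ≡ true

  InVplus : Fin n → Set
  InVplus x = weight x > 1

  SubsetVplus : Subset n → Set
  SubsetVplus A = ∀ x → x ∈ A → InVplus x

  OutNbhdSubset : Subset n → Subset n → Set
  OutNbhdSubset A S = ∀ a y → a ∈ A → Edge a y → y ∈ S

  IsVertexCover : Subset n → Set
  IsVertexCover C = ∀ x y → Edge x y → x ∈ C ⊎ y ∈ C

  InL1 : Subset n → Fin n → Set
  InL1 C x = x ∈ C × ∃[ y ] (Edge x y × y ∉ C)

  InL2 : Subset n → Fin n → Set
  InL2 C x = x ∈ C × ¬ InL1 C x × ∃[ y ] (Edge y x × y ∉ C)

  InL3 : Subset n → Fin n → Set
  InL3 C x = x ∈ C × ¬ InL1 C x × ¬ InL2 C x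

  IsStrongVertexCover : Subset n → Set
  IsStrongVertexCover C =
    IsVertexCover C ×
    (∀ x → InL3 C x →
      ∃[ y ] (Edge y x × y ∈ C × ¬ InL1 C y × InVplus y))

-- A vertex x ∈ L₃(C) has all its neighbours in C, so C ∖ {x} is still a vertex cover.
-- If C is not strong, pick such an x with no in-neighbour in (C ∖ L₁(C)) ∩ V⁺ and remove it.
-- This cannot break N⁺(A) ⊆ C: an arc a → x with a ∈ A would make a itself such an
-- in-neighbour (a ∈ C because x ∈ L₃, a ∉ L₁ because N⁺(a) ⊆ C, a ∈ V⁺ because A ⊆ V⁺).
-- Induction on |C| then ends at a strong vertex cover.
module Submission where

open import Defs
open import Data.Nat using (ℕ; _<_; _<?_)
open import Data.Nat.Induction using (<-wellFounded)
open import Data.Fin using (Fin)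
open import Data.Fin.Properties using (any?; all?; ¬∀⟶∃¬) renaming (_≟_ to _≟ᶠ_)
open import Data.Fin.Subset using (Subset; _⊆_; _∈_; _-_; ∣_∣)
open import Data.Fin.Subset.Properties
  using (_∈?_; x∈p∧x≢y⇒x∈p-y; x∈p⇒p-x⊂p; x∈p⇒∣p-x∣<∣p∣)
open import Data.Bool using (true) renaming (_≟_ to _≟ᵇ_)
open import Data.Product using (∃; ∃-syntax; _×_; _,_; proj₁)
open import Data.Sum using (_⊎_; inj₁; inj₂)
open import Data.Empty using (⊥-elim)
open import Induction.WellFounded using (Acc; acc)
open import Relation.Nullary using (¬_; Dec; yes; no; contradiction)
open import Relation.Nullary.Decidable using (_×-dec_; ¬?; _→-dec_)
open import Relation.Binary.PropositionalEquality using (_≢_; refl; sym; trans)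

module _ {n : ℕ} (D : WOG n) where
  open WOG D

  StrongWitness : Subset n → Fin n → Set
  StrongWitness C x = ∃[ y ] (Edge D y x × y ∈ C × ¬ InL1 D C y × InVplus D y)

  WeakVertex : Subset n → Fin n → Set
  WeakVertex C x = InL3 D C x × ¬ StrongWitness C x

  edge? : ∀ x y → Dec (Edge D x y)
  edge? x y = arc x y ≟ᵇ true

  inL1? : ∀ C x → Dec (InL1 D C x)
  inL1? C x = (x ∈? C) ×-dec any? (λ y → edge? x y ×-dec ¬? (y ∈? C))

  inL2? : ∀ C x → Dec (InL2 D C x)
  inL2? C x = (x ∈? C) ×-dec ¬? (inL1? C x) ×-dec any? (λ y → edge? y x ×-dec ¬? (y ∈? C))

  inL3? : ∀ C x → Dec (InL3 D C x)
  inL3? C x = (x ∈? C) ×-dec ¬? (inL1? C x) ×-dec ¬? (inL2? C x)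

  strongWitness? : ∀ C x → Dec (StrongWitness C x)
  strongWitness? C x =
    any? (λ y → edge? y x ×-dec (y ∈? C) ×-dec ¬? (inL1? C y) ×-dec (1 <? weight y))

  edge⇒≢ : ∀ {x y} → Edge D x y → x ≢ y
  edge⇒≢ {x} e refl with () ← trans (sym e) (noLoop x)

  ¬InL1⇒outNbhd⊆ : ∀ {C x y} → x ∈ C → ¬ InL1 D C x → Edge D x y → y ∈ C
  ¬InL1⇒outNbhd⊆ {C} {x} {y} x∈C x∉L1 e with y ∈? C
  ... | yes y∈C = y∈C
  ... | no  y∉C = contradiction (x∈C , y , e , y∉C) x∉L1

  InL3⇒inNbhd⊆ : ∀ {C x y} → InL3 D C x → Edge D y x → y ∈ C
  InL3⇒inNbhd⊆ {C} {x} {y} (x∈C , x∉L1 , x∉L2) e with y ∈? C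
  ... | yes y∈C = y∈C
  ... | no  y∉C = contradiction (x∈C , x∉L1 , y , e , y∉C) x∉L2

  strong⊎weakVertex : ∀ {C} → IsVertexCover D C →
                      IsStrongVertexCover D C ⊎ ∃ (WeakVertex C)
  strong⊎weakVertex {C} cover with all? (λ x → inL3? C x →-dec strongWitness? C x)
  ... | yes strong = inj₁ (cover , strong)
  ... | no  weak with ¬∀⟶∃¬ n _ (λ x → inL3? C x →-dec strongWitness? C x) weak
  ...   | x , ¬strong with inL3? C x
  ...     | yes x∈L3 = inj₂ (x , x∈L3 , λ w → ¬strong (λ _ → w))
  ...     | no  x∉L3 = ⊥-elim (¬strong (λ x∈L3 → contradiction x∈L3 x∉L3))

  vertexCover-removeL3 : ∀ {C x} → IsVertexCover D C → InL3 D C x →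
                         IsVertexCover D (C - x)
  vertexCover-removeL3 {C} {x} cover x∈L3@(x∈C , x∉L1 , _) u v e with u ≟ᶠ x | v ≟ᶠ x
  ... | yes refl | _        =
    inj₂ (x∈p∧x≢y⇒x∈p-y (¬InL1⇒outNbhd⊆ x∈C x∉L1 e) (λ v≡x → edge⇒≢ e (sym v≡x)))
  ... | no u≢x   | yes refl = inj₁ (x∈p∧x≢y⇒x∈p-y (InL3⇒inNbhd⊆ x∈L3 e) u≢x)
  ... | no u≢x   | no v≢x with cover u v e
  ...   | inj₁ u∈C = inj₁ (x∈p∧x≢y⇒x∈p-y u∈C u≢x)
  ...   | inj₂ v∈C = inj₂ (x∈p∧x≢y⇒x∈p-y v∈C v≢x)

  outNbhdSubset-removeWeak : ∀ {A C x} → SubsetVplus D A → OutNbhdSubset D A C →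
                             WeakVertex C x → OutNbhdSubset D A (C - x)
  outNbhdSubset-removeWeak {A} {C} {x} A⊆V⁺ N⁺A⊆C (x∈L3 , ¬strong) a y a∈A e
    with y ≟ᶠ x
  ... | no  y≢x  = x∈p∧x≢y⇒x∈p-y (N⁺A⊆C a y a∈A e) y≢x
  ... | yes refl = contradiction witness ¬strong
    where
    a∉L1 : ¬ InL1 D C a
    a∉L1 (_ , z , e′ , z∉C) = z∉C (N⁺A⊆C a z a∈A e′)
    witness : StrongWitness C x
    witness = a , e , InL3⇒inNbhd⊆ x∈L3 e , a∉L1 , A⊆V⁺ a a∈A

  strongSubcover : ∀ A C → Acc _<_ ∣ C ∣ →
                   SubsetVplus D A → IsVertexCover D C → OutNbhdSubset D A C →
                   ∃[ C′ ] (IsStrongVertexCover D C′ × OutNbhdSubset D A C′ × C′ ⊆ C)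
  strongSubcover A C (acc rec) A⊆V⁺ cover N⁺A⊆C with strong⊎weakVertex cover
  ... | inj₁ strong = C , strong , N⁺A⊆C , λ p → p
  ... | inj₂ (x , weak@(x∈L3@(x∈C , _) , _))
    with C′ , strong , N⁺A⊆C′ , C′⊆C-x ←
      strongSubcover A (C - x) (rec (x∈p⇒∣p-x∣<∣p∣ x∈C)) A⊆V⁺
        (vertexCover-removeL3 cover x∈L3)
        (outNbhdSubset-removeWeak A⊆V⁺ N⁺A⊆C weak)
    = C′ , strong , N⁺A⊆C′ , λ p → proj₁ (x∈p⇒p-x⊂p x∈C) (C′⊆C-x p)

proposition3p1 : ∀ {n : ℕ} (D : WOG n) (A C : Subset n) →
    SubsetVplus D A → IsVertexCover D C → OutNbhdSubset D A C →
    ∃[ C′ ] (IsStrongVertexCover D C′ × OutNbhdSubset D A C′ × C′ ⊆ C)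
proposition3p1 D A C = strongSubcover D A C (<-wellFounded ∣ C ∣)
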